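{- Let $G_0$ be a finite simple undirected graph and let $w_1,w_2,\ldots$ be distinct new vertices not in $V(G_0)$. Define graphs $G_1,G_2,\ldots$ recursively by $G_i=G_{i-1}\cup w_i$ if $i\ge 1$ is odd and $G_i=G_{i-1}\vee w_i$ if $i\ge1$ is even. Let $a:=|\det(A(G_0))|$, $b:=|\det(W(G_0))|$ and $p:=|\det(A(\overline{G}_1))|$, where $\overline{G}_1$ is the complement of $G_1$. Then for all $i\ge 1$, $$|\det(W(G_i))|=a^{\lceil i/2\rceil}\, b\, p^{\lfloor i/2\rfloor}.$$
   Context: For a graph $H$, $A(H)$ denotes its adjacency matrix and $W(H)=[e,A(H)e,\ldots,A(H)^{m-1}e]$ its walk matrix, where $m=|V(H)|$ and $e$ is the all-ones vector of length $m$. For a graph $H$ and a new vertex $w\notin V(H)$, $H\cup w$ is obtained from $H$ by adding $w$ as an isolated vertex, and $H\vee w$ is obtained from $H$ by adding $w$ and joining it to every vertex of $H$. -}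

module Defs where

open import Data.Bool using (Bool; true; false; not; if_then_else_)
open import Data.Nat using (ℕ; zero; suc)
open import Data.Fin using (Fin; zero; suc; toℕ; punchIn; _≟_)
open import Data.Integer using (ℤ; +_; _+_; _*_; -_)
open import Relation.Nullary using (yes; no)
open import Relation.Binary.PropositionalEquality using (_≡_)

Graph : ℕ → Set
Graph n = Fin n → Fin n → Bool

IsSimple : ∀ {n} → Graph n → Set
IsSimple {n} g = (∀ i j → g i j ≡ g j i) × (∀ i → g i i ≡ false)
  where open import Data.Product using (_×_)

Mat : ℕ → Set
Mat n = Fin n → Fin n → ℤ

∑ : ∀ {n} → (Fin n → ℤ) → ℤ
∑ {zero}  f = + 0
∑ {suc n} f = f zero + ∑ (λ i → f (suc i))

sgn : ℕ → ℤ
sgn zero = + 1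
sgn (suc k) = - sgn k

det : ∀ {n} → Mat n → ℤ
det {zero}  M = + 1
det {suc n} M = ∑ (λ j → sgn (toℕ j) * M zero j * det (λ r c → M (suc r) (punchIn j c)))

adjMat : ∀ {n} → Graph n → Mat n
adjMat g i j = if g i j then + 1 else + 0

walkVec : ∀ {n} → Mat n → ℕ → Fin n → ℤ
walkVec A zero    i = + 1
walkVec A (suc k) i = ∑ (λ j → A i j * walkVec A k j)

walkMat : ∀ {n} → Graph n → Mat n
walkMat g i k = walkVec (adjMat g) (toℕ k) i

-- H ∪ w : new vertex w is index zero, isolated
addIsolated : ∀ {n} → Graph n → Graph (suc n)
addIsolated g zero    zero    = false
addIsolated g zero    (suc j) = false
addIsolated g (suc i) zero    = false
addIsolated g (suc i) (suc j) = g i j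

-- H ∨ w : new vertex w is index zero, joined to every vertex of H
addCone : ∀ {n} → Graph n → Graph (suc n)
addCone g zero    zero    = false
addCone g zero    (suc j) = true
addCone g (suc i) zero    = true
addCone g (suc i) (suc j) = g i j

complement : ∀ {n} → Graph n → Graph n
complement g i j with i ≟ j
... | yes _ = false
... | no  _ = not (g i j)

isOdd : ℕ → Bool
isOdd zero = false
isOdd (suc k) = not (isOdd k)

seqG : ∀ {n} → Graph n → (i : ℕ) → Graph (i Data.Nat.+ n)
seqG g zero    = g
seqG g (suc i) = if isOdd (suc i) then addIsolated (seqG g i) else addCone (seqG g i)

-- Adding an isolated vertex w to H gives W(H ∪ w) the first row (1, 0, …, 0) with complementary
-- minor A(H)·W(H), so det W(H ∪ w) = det A(H) · det W(H); multiplicativity of det comes from the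
-- uniqueness of alternating multilinear forms. For loopless H we have A(H̄) = J − I − A(H), so each
-- walk vector A(H̄)^k e is (−1)^k A(H)^k e plus a combination of lower walk vectors of H. Hence
-- W(H̄) = W(H)·U with U triangular and diagonal ±1, and |det W(H̄)| = |det W(H)|. As the complement
-- of H ∨ w is H̄ ∪ w, this yields |det W(H ∨ w)| = |det A(H̄)| · |det W(H)|. Finally
-- det A((H ∪ u) ∨ w) = −det A(H) gives |det A(G₂ₖ)| = a and |det A(Ḡ₂ₖ₊₁)| = p for every k, so the
-- odd steps multiply |det W| by a and the even steps by p.

module Submission where

open import Data.Bool using (true; false; if_then_else_)
open import Data.Empty using (⊥-elim)
open import Data.Fin as Fin using (Fin; zero; suc; toℕ; punchIn; punchOut; inject₁)
open import Data.Fin.Properties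
  using (suc-injective; punchIn-injective; punchInᵢ≢i; punchIn-punchOut; toℕ-injective; toℕ-inject₁; toℕ-fromℕ<; toℕ<n)
open import Data.Integer using (ℤ; +_; -_; _+_; _*_; ∣_∣)
import Data.Integer.Properties as ℤ
open import Algebra.Properties.AbelianGroup ℤ.+-0-abelianGroup using (identityʳ-unique; inverseʳ-unique)
open import Algebra.Properties.CommutativeSemigroup ℤ.+-commutativeSemigroup using (interchange)
open import Data.Integer.Tactic.RingSolver using (solve-∀)
open import Data.Nat as ℕ using (ℕ; zero; suc; ⌈_/2⌉; ⌊_/2⌋)
import Data.Nat.Properties as ℕ
import Data.Nat.Tactic.RingSolver as ℕ-Solver
open import Data.Product using (∃; _×_; _,_)
open import Data.Sum using (_⊎_; inj₁; inj₂)
open import Function using (_∘_)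
open import Relation.Binary using (tri<; tri≈; tri>)
open import Relation.Binary.PropositionalEquality
open import Relation.Nullary using (Dec; yes; no)
open ≡-Reasoning

open import Defs

∑-cong : ∀ {n} {f g : Fin n → ℤ} → (∀ j → f j ≡ g j) → ∑ f ≡ ∑ g
∑-cong {zero}  f≗g = refl
∑-cong {suc n} f≗g = cong₂ _+_ (f≗g zero) (∑-cong (f≗g ∘ suc))

∑-zero : ∀ {n} {f : Fin n → ℤ} → (∀ j → f j ≡ + 0) → ∑ f ≡ + 0
∑-zero {zero}  f≗0 = refl
∑-zero {suc n} f≗0 = cong₂ _+_ (f≗0 zero) (∑-zero (f≗0 ∘ suc))

∑-single : ∀ {n} (f : Fin n → ℤ) k → (∀ j → j ≢ k → f j ≡ + 0) → ∑ f ≡ f k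
∑-single f zero f≗0 =
  trans (cong (_+_ (f zero)) (∑-zero λ j → f≗0 (suc j) λ ())) (ℤ.+-identityʳ (f zero))
∑-single f (suc k) f≗0 =
  trans (cong₂ _+_ (f≗0 zero λ ()) (∑-single (f ∘ suc) k λ j j≢k → f≗0 (suc j) (j≢k ∘ suc-injective)))
        (ℤ.+-identityˡ (f (suc k)))

∑-distrib-+ : ∀ {n} (f g : Fin n → ℤ) → ∑ (λ j → f j + g j) ≡ ∑ f + ∑ g
∑-distrib-+ {zero}  f g = refl
∑-distrib-+ {suc n} f g =
  trans (cong (_+_ (f zero + g zero)) (∑-distrib-+ (f ∘ suc) (g ∘ suc))) (interchange (f zero) (g zero) (∑ (f ∘ suc)) (∑ (g ∘ suc)))

*-distribˡ-∑ : ∀ {n} c (f : Fin n → ℤ) → c * ∑ f ≡ ∑ (λ j → c * f j)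
*-distribˡ-∑ {zero}  c f = ℤ.*-zeroʳ c
*-distribˡ-∑ {suc n} c f =
  trans (ℤ.*-distribˡ-+ c (f zero) _) (cong (_+_ (c * f zero)) (*-distribˡ-∑ c (f ∘ suc)))

*-distribʳ-∑ : ∀ {n} c (f : Fin n → ℤ) → ∑ f * c ≡ ∑ (λ j → f j * c)
*-distribʳ-∑ c f =
  trans (ℤ.*-comm (∑ f) c) (trans (*-distribˡ-∑ c f) (∑-cong λ j → ℤ.*-comm c (f j)))

neg-distrib-∑ : ∀ {n} (f : Fin n → ℤ) → - ∑ f ≡ ∑ (λ j → - f j)
neg-distrib-∑ {zero}  f = refl
neg-distrib-∑ {suc n} f =
  trans (ℤ.neg-distrib-+ (f zero) _) (cong (_+_ (- f zero)) (neg-distrib-∑ (f ∘ suc)))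

∑-neg-+-* : ∀ {n} (f g x : Fin n → ℤ) → ∑ (λ j → (- f j + - g j) * x j) ≡ - ∑ (λ j → f j * x j) + - ∑ (λ j → g j * x j)
∑-neg-+-* f g x = begin
  ∑ (λ j → (- f j + - g j) * x j)                    ≡⟨ ∑-cong (λ j → distrib (f j) (g j) (x j)) ⟩
  ∑ (λ j → - (f j * x j) + - (g j * x j))            ≡⟨ ∑-distrib-+ (λ j → - (f j * x j)) (λ j → - (g j * x j)) ⟩
  ∑ (λ j → - (f j * x j)) + ∑ (λ j → - (g j * x j))  ≡⟨ cong₂ _+_ (neg-distrib-∑ (λ j → f j * x j)) (neg-distrib-∑ (λ j → g j * x j)) ⟨
  - ∑ (λ j → f j * x j) + - ∑ (λ j → g j * x j)      ∎
  where
  distrib : ∀ a b y → (- a + - b) * y ≡ - (a * y) + - (b * y)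
  distrib = solve-∀

∑-pairCancels : ∀ {n} (f : Fin (suc (suc n)) → ℤ) k → f (inject₁ k) + f (suc k) ≡ + 0 →
  (∀ j → j ≢ inject₁ k → j ≢ suc k → f j ≡ + 0) → ∑ f ≡ + 0
∑-pairCancels f zero pair others = begin
  f zero + (f (suc zero) + ∑ (λ j → f (suc (suc j))))   ≡⟨ ℤ.+-assoc (f zero) _ _ ⟨
  f zero + f (suc zero) + ∑ (λ j → f (suc (suc j)))     ≡⟨ cong₂ _+_ pair (∑-zero λ j → others (suc (suc j)) (λ ()) (λ ())) ⟩
  + 0                                                   ∎
∑-pairCancels {suc n} f (suc k) pair others =
  cong₂ _+_ (others zero (λ ()) (λ ()))
            (∑-pairCancels (f ∘ suc) k pair λ j j≢k j≢k+1 → others (suc j) (j≢k ∘ suc-injective) (j≢k+1 ∘ suc-injective))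

∑-comm : ∀ {m n} (f : Fin m → Fin n → ℤ) → ∑ (λ i → ∑ (f i)) ≡ ∑ (λ j → ∑ (λ i → f i j))
∑-comm {zero} {n} f = sym (∑-zero {n} λ _ → refl)
∑-comm {suc m} f =
  trans (cong (_+_ (∑ (f zero))) (∑-comm (f ∘ suc))) (sym (∑-distrib-+ (f zero) _))

-- Column linearity and alternation of the determinant

infix 4 _≋_ _≋_off_
_≋_ : ∀ {n} → Mat n → Mat n → Set
M ≋ N = ∀ i j → M i j ≡ N i j

_≋_off_ : ∀ {n} → Mat n → Mat n → Fin n → Set
M ≋ N off k = ∀ i j → j ≢ k → M i j ≡ N i j

minor : ∀ {n} → Fin (suc n) → Mat (suc n) → Mat n
minor j M r c = M (suc r) (punchIn j c)

cofactorTerm : ∀ {n} → Mat (suc n) → Fin (suc n) → ℤ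
cofactorTerm M j = sgn (toℕ j) * M zero j * det (minor j M)

det-cong : ∀ {n} {M N : Mat n} → M ≋ N → det M ≡ det N
det-cong {zero}  M≋N = refl
det-cong {suc n} M≋N = ∑-cong λ j →
  cong₂ (λ a d → sgn (toℕ j) * a * d) (M≋N zero j) (det-cong λ r c → M≋N (suc r) (punchIn j c))

minor-cong : ∀ {n} {M N : Mat (suc n)} k → M ≋ N off k → minor k M ≋ minor k N
minor-cong k M≋N r c = M≋N (suc r) (punchIn k c) (punchInᵢ≢i k c)

ColumnLinear : ∀ {n} → (Mat n → ℤ) → Set
ColumnLinear {n} D = ∀ k c (M N P : Mat n) → M ≋ N off k → M ≋ P off k →
  (∀ i → M i k ≡ c * N i k + P i k) → D M ≡ c * D N + D P

det-linear : ∀ {n} → ColumnLinear (det {n})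
det-linear {suc n} k c M N P M≋N M≋P Mₖ = begin
  ∑ (cofactorTerm M)                                        ≡⟨ ∑-cong term-linear ⟩
  ∑ (λ j → c * cofactorTerm N j + cofactorTerm P j)         ≡⟨ ∑-distrib-+ (λ j → c * cofactorTerm N j) (cofactorTerm P) ⟩
  ∑ (λ j → c * cofactorTerm N j) + det P                    ≡⟨ cong (_+ det P) (*-distribˡ-∑ c (cofactorTerm N)) ⟨
  c * det N + det P                                         ∎
  where
  term-linear : ∀ j → cofactorTerm M j ≡ c * cofactorTerm N j + cofactorTerm P j
  term-linear j with j Fin.≟ k
  ... | yes refl = begin
      s * M zero j * det (minor j M)                       ≡⟨ cong₂ (λ a d → s * a * d) (Mₖ zero) (det-cong (minor-cong j M≋N)) ⟩
      s * (c * N zero j + P zero j) * det (minor j N)      ≡⟨ distrib s c (N zero j) (P zero j) (det (minor j N)) ⟩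
      c * cofactorTerm N j + s * P zero j * det (minor j N) ≡⟨ cong (λ d → c * cofactorTerm N j + s * P zero j * d) minorN≡minorP ⟩
      c * cofactorTerm N j + cofactorTerm P j              ∎
    where
    s = sgn (toℕ j)
    distrib : ∀ s c a b d → s * (c * a + b) * d ≡ c * (s * a * d) + s * b * d
    distrib = solve-∀
    minorN≡minorP : det (minor j N) ≡ det (minor j P)
    minorN≡minorP = det-cong λ r c′ → trans (sym (minor-cong j M≋N r c′)) (minor-cong j M≋P r c′)
  ... | no j≢k = begin
      s * M zero j * det (minor j M)                       ≡⟨ cong₂ (λ a d → s * a * d) (M≋N zero j j≢k) minor-linear ⟩
      s * N zero j * (c * det (minor j N) + det (minor j P)) ≡⟨ distrib s (N zero j) c (det (minor j N)) (det (minor j P)) ⟩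
      c * cofactorTerm N j + s * N zero j * det (minor j P) ≡⟨ cong (λ a → c * cofactorTerm N j + s * a * det (minor j P)) N≡P ⟩
      c * cofactorTerm N j + cofactorTerm P j              ∎
    where
    s = sgn (toℕ j)
    k′ = punchOut j≢k
    distrib : ∀ s a c x y → s * a * (c * x + y) ≡ c * (s * a * x) + s * a * y
    distrib = solve-∀
    N≡P : N zero j ≡ P zero j
    N≡P = trans (sym (M≋N zero j j≢k)) (M≋P zero j j≢k)
    avoids-k : ∀ {c′} → c′ ≢ k′ → punchIn j c′ ≢ k
    avoids-k c′≢k′ eq = c′≢k′ (punchIn-injective j _ _ (trans eq (sym (punchIn-punchOut j≢k))))
    minor-linear : det (minor j M) ≡ c * det (minor j N) + det (minor j P)
    minor-linear = det-linear k′ c (minor j M) (minor j N) (minor j P)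
      (λ r c′ c′≢k′ → M≋N (suc r) (punchIn j c′) (avoids-k c′≢k′))
      (λ r c′ c′≢k′ → M≋P (suc r) (punchIn j c′) (avoids-k c′≢k′))
      (λ r → subst (λ x → M (suc r) x ≡ c * N (suc r) x + P (suc r) x) (sym (punchIn-punchOut j≢k)) (Mₖ (suc r)))

linear-additive : ∀ {n} {D : Mat n → ℤ} → ColumnLinear D → ∀ k (M N P : Mat n) →
  M ≋ N off k → M ≋ P off k → (∀ i → M i k ≡ N i k + P i k) → D M ≡ D N + D P
linear-additive {D = D} lin k M N P M≋N M≋P Mₖ =
  trans (lin k (+ 1) M N P M≋N M≋P λ i → trans (Mₖ i) (cong (_+ P i k) (sym (ℤ.*-identityˡ (N i k)))))
        (cong (_+ D P) (ℤ.*-identityˡ (D N)))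

linear-zeroColumn : ∀ {n} {D : Mat n → ℤ} → ColumnLinear D → ∀ M k → (∀ i → M i k ≡ + 0) → D M ≡ + 0
linear-zeroColumn {D = D} lin M k Mₖ≡0 = identityʳ-unique (D M) (D M) (sym
  (linear-additive lin k M M M (λ _ _ _ → refl) (λ _ _ _ → refl) λ i → trans (Mₖ≡0 i) (cong₂ _+_ (sym (Mₖ≡0 i)) (sym (Mₖ≡0 i)))))

inject₁≢suc : ∀ {n} (k : Fin n) → inject₁ k ≢ suc k
inject₁≢suc (suc k) eq = inject₁≢suc k (suc-injective eq)

punchIn-inject₁-diag : ∀ {n} (k : Fin n) → punchIn (inject₁ k) k ≡ suc k
punchIn-inject₁-diag zero    = refl
punchIn-inject₁-diag (suc k) = cong suc (punchIn-inject₁-diag k)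

punchIn-suc-diag : ∀ {n} (k : Fin n) → punchIn (suc k) k ≡ inject₁ k
punchIn-suc-diag zero    = refl
punchIn-suc-diag (suc k) = cong suc (punchIn-suc-diag k)

punchIn-inject₁≡punchIn-suc : ∀ {n} {k c : Fin n} → c ≢ k → punchIn (inject₁ k) c ≡ punchIn (suc k) c
punchIn-inject₁≡punchIn-suc {k = zero}  {zero}  c≢k = ⊥-elim (c≢k refl)
punchIn-inject₁≡punchIn-suc {k = zero}  {suc c} c≢k = refl
punchIn-inject₁≡punchIn-suc {k = suc k} {zero}  c≢k = refl
punchIn-inject₁≡punchIn-suc {k = suc k} {suc c} c≢k = cong suc (punchIn-inject₁≡punchIn-suc (c≢k ∘ cong suc))

punchIn-adjacent : ∀ {n} (j : Fin (suc (suc n))) (k : Fin (suc n)) → j ≢ inject₁ k → j ≢ suc k →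
  ∃ λ c → punchIn j (inject₁ c) ≡ inject₁ k × punchIn j (suc c) ≡ suc k
punchIn-adjacent         zero          zero    j≢k j≢k+1 = ⊥-elim (j≢k refl)
punchIn-adjacent         zero          (suc k) j≢k j≢k+1 = k , refl , refl
punchIn-adjacent         (suc zero)    zero    j≢k j≢k+1 = ⊥-elim (j≢k+1 refl)
punchIn-adjacent {suc n} (suc (suc j)) zero    j≢k j≢k+1 = zero , refl , refl
punchIn-adjacent {suc n} (suc j)       (suc k) j≢k j≢k+1 with punchIn-adjacent j k (j≢k ∘ cong suc) (j≢k+1 ∘ cong suc)
... | c , p₁ , p₂ = suc c , cong suc p₁ , cong suc p₂

det-adjacentEqual : ∀ {n} (M : Mat (suc (suc n))) k → (∀ i → M i (inject₁ k) ≡ M i (suc k)) → det M ≡ + 0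
det-adjacentEqual-minor : ∀ {n} (M : Mat (suc (suc n))) j k (c : Fin n) →
  punchIn j (inject₁ c) ≡ inject₁ k → punchIn j (suc c) ≡ suc k →
  (∀ i → M i (inject₁ k) ≡ M i (suc k)) → det (minor j M) ≡ + 0
det-adjacentEqual-minor {suc n} M j k c p₁ p₂ Mₖ =
  det-adjacentEqual (minor j M) c λ i → trans (cong (M (suc i)) p₁) (trans (Mₖ (suc i)) (cong (M (suc i)) (sym p₂)))

det-adjacentEqual M k Mₖ = ∑-pairCancels (cofactorTerm M) k pair-cancels others-vanish
  where
  minors-equal : minor (inject₁ k) M ≋ minor (suc k) M
  minors-equal r c with c Fin.≟ k
  ... | yes refl = begin
    M (suc r) (punchIn (inject₁ c) c)  ≡⟨ cong (M (suc r)) (punchIn-inject₁-diag c) ⟩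
    M (suc r) (suc c)                  ≡⟨ Mₖ (suc r) ⟨
    M (suc r) (inject₁ c)              ≡⟨ cong (M (suc r)) (punchIn-suc-diag c) ⟨
    M (suc r) (punchIn (suc c) c)      ∎
  ... | no c≢k = cong (M (suc r)) (punchIn-inject₁≡punchIn-suc c≢k)
  cancel : ∀ s a d → s * a * d + (- s) * a * d ≡ + 0
  cancel = solve-∀
  pair-cancels : cofactorTerm M (inject₁ k) + cofactorTerm M (suc k) ≡ + 0
  pair-cancels rewrite toℕ-inject₁ k | Mₖ zero | det-cong minors-equal =
    cancel (sgn (toℕ k)) (M zero (suc k)) (det (minor (suc k) M))
  others-vanish : ∀ j → j ≢ inject₁ k → j ≢ suc k → cofactorTerm M j ≡ + 0
  others-vanish j j≢k j≢k+1 with punchIn-adjacent j k j≢k j≢k+1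
  ... | c , p₁ , p₂ = trans (cong (sgn (toℕ j) * M zero j *_) (det-adjacentEqual-minor M j k c p₁ p₂ Mₖ))
                            (ℤ.*-zeroʳ (sgn (toℕ j) * M zero j))

column : ∀ {n} → Mat n → Fin n → Fin n → ℤ
column M k i = M i k

replaceCol : ∀ {n} → Fin n → (Fin n → ℤ) → Mat n → Mat n
replaceCol k v M i j with j Fin.≟ k
... | yes _ = v i
... | no  _ = M i j

replaceCol-at : ∀ {n} k (v : Fin n → ℤ) M i → replaceCol k v M i k ≡ v i
replaceCol-at k v M i with k Fin.≟ k
... | yes _  = refl
... | no k≢k = ⊥-elim (k≢k refl)

replaceCol-off : ∀ {n} {k j} (v : Fin n → ℤ) M i → j ≢ k → replaceCol k v M i j ≡ M i j
replaceCol-off {k = k} {j} v M i j≢k with j Fin.≟ k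
... | yes j≡k = ⊥-elim (j≢k j≡k)
... | no  _   = refl

replaceCol-column : ∀ {n} k (M : Mat n) → replaceCol k (column M k) M ≋ M
replaceCol-column k M i j with j Fin.≟ k
... | yes refl = refl
... | no  _    = refl

replaceCol-cong-off : ∀ {n} {M N : Mat n} {b} a v → M ≋ N off b → replaceCol a v M ≋ replaceCol a v N off b
replaceCol-cong-off a v M≋N i j j≢b with j Fin.≟ a
... | yes _ = refl
... | no  _ = M≋N i j j≢b

swapCols : ∀ {n} → Fin n → Fin n → Mat n → Mat n
swapCols a b M = replaceCol a (column M b) (replaceCol b (column M a) M)

swapCols-at₁ : ∀ {n} a b (M : Mat n) i → swapCols a b M i a ≡ M i b
swapCols-at₁ a b M = replaceCol-at a (column M b) _

swapCols-at₂ : ∀ {n} {a b} (M : Mat n) i → a ≢ b → swapCols a b M i b ≡ M i a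
swapCols-at₂ {a = a} {b} M i a≢b =
  trans (replaceCol-off (column M b) _ i (a≢b ∘ sym)) (replaceCol-at b (column M a) M i)

swapCols-off : ∀ {n} {a b j} (M : Mat n) i → j ≢ a → j ≢ b → swapCols a b M i j ≡ M i j
swapCols-off {a = a} {b} M i j≢a j≢b =
  trans (replaceCol-off (column M b) _ i j≢a) (replaceCol-off (column M a) M i j≢b)

alternating⇒antisymmetric : ∀ {A : Set} (_⊕_ : A → A → A) (B : A → A → ℤ) →
  (∀ x y z → B (x ⊕ y) z ≡ B x z + B y z) → (∀ x y z → B x (y ⊕ z) ≡ B x y + B x z) →
  (∀ x → B x x ≡ + 0) → ∀ x y → B y x ≡ - B x y
alternating⇒antisymmetric _⊕_ B additiveˡ additiveʳ diagonal x y = inverseʳ-unique (B x y) (B y x) (begin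
  B x y + B y x                         ≡⟨ cong₂ _+_ (ℤ.+-identityˡ (B x y)) (ℤ.+-identityʳ (B y x)) ⟨
  + 0 + B x y + (B y x + + 0)           ≡⟨ cong₂ (λ p q → p + B x y + (B y x + q)) (diagonal x) (diagonal y) ⟨
  B x x + B x y + (B y x + B y y)       ≡⟨ cong₂ _+_ (additiveʳ x x y) (additiveʳ y x y) ⟨
  B x (x ⊕ y) + B y (x ⊕ y)             ≡⟨ additiveˡ x y (x ⊕ y) ⟨
  B (x ⊕ y) (x ⊕ y)                     ≡⟨ diagonal (x ⊕ y) ⟩
  + 0                                   ∎)

swapCols-negates : ∀ {n} {D : Mat n → ℤ} → (∀ {M N} → M ≋ N → D M ≡ D N) → ColumnLinear D →
  ∀ {a b} → a ≢ b → (∀ M → (∀ i → M i a ≡ M i b) → D M ≡ + 0) → ∀ M → D (swapCols a b M) ≡ - D M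
swapCols-negates {n} {D} resp lin {a} {b} a≢b vanish M =
  trans (alternating⇒antisymmetric _⊕_ B additiveˡ additiveʳ diagonal (column M a) (column M b))
        (cong -_ (resp restore))
  where
  _⊕_ : (Fin n → ℤ) → (Fin n → ℤ) → Fin n → ℤ
  (x ⊕ y) i = x i + y i
  B : (Fin n → ℤ) → (Fin n → ℤ) → ℤ
  B x y = D (replaceCol a x (replaceCol b y M))
  at-b : ∀ x y i → replaceCol a x (replaceCol b y M) i b ≡ y i
  at-b x y i = trans (replaceCol-off x _ i (a≢b ∘ sym)) (replaceCol-at b y M i)
  off-a : ∀ x y N → replaceCol a x N ≋ replaceCol a y N off a
  off-a x y N i j j≢a = trans (replaceCol-off x N i j≢a) (sym (replaceCol-off y N i j≢a))
  off-b : ∀ x y z → replaceCol a x (replaceCol b y M) ≋ replaceCol a x (replaceCol b z M) off b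
  off-b x y z = replaceCol-cong-off a x λ i j j≢b → trans (replaceCol-off y M i j≢b) (sym (replaceCol-off z M i j≢b))
  additiveˡ : ∀ x y z → B (x ⊕ y) z ≡ B x z + B y z
  additiveˡ x y z = linear-additive lin a _ _ _ (off-a (x ⊕ y) x _) (off-a (x ⊕ y) y _) λ i →
    trans (replaceCol-at a (x ⊕ y) _ i) (sym (cong₂ _+_ (replaceCol-at a x _ i) (replaceCol-at a y _ i)))
  additiveʳ : ∀ x y z → B x (y ⊕ z) ≡ B x y + B x z
  additiveʳ x y z = linear-additive lin b _ _ _ (off-b x (y ⊕ z) y) (off-b x (y ⊕ z) z) λ i →
    trans (at-b x (y ⊕ z) i) (sym (cong₂ _+_ (at-b x y i) (at-b x z i)))
  diagonal : ∀ x → B x x ≡ + 0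
  diagonal x = vanish _ λ i → trans (replaceCol-at a x _ i) (sym (at-b x x i))
  restore : replaceCol a (column M a) (replaceCol b (column M b) M) ≋ M
  restore i j with j Fin.≟ a
  ... | yes refl = refl
  ... | no  _    = replaceCol-column b M i j

-- Induction on l: swapping column l with its left neighbour only flips the sign.
det-equalColumns< : ∀ m {n} (M : Mat n) k l → toℕ l ≡ m → toℕ k ℕ.< toℕ l → (∀ i → M i k ≡ M i l) → det M ≡ + 0
det-equalColumns< zero M k l l≡0 k<l _ = ⊥-elim (ℕ.n≮0 (subst (toℕ k ℕ.<_) l≡0 k<l))
det-equalColumns< (suc m) {suc zero} M k (suc ())
det-equalColumns< (suc m) {suc (suc n)} M k (suc l) l≡m k<l Mₖ≡Mₗ with toℕ k ℕ.≟ toℕ l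
... | yes k≡l = det-adjacentEqual M l λ i → subst (λ c → M i c ≡ M i (suc l)) k≡inject₁l (Mₖ≡Mₗ i)
  where
  k≡inject₁l : k ≡ inject₁ l
  k≡inject₁l = toℕ-injective (trans k≡l (sym (toℕ-inject₁ l)))
... | no k≢l = ℤ.neg-injective (trans (sym (swapCols-negates det-cong det-linear (inject₁≢suc l) (λ N → det-adjacentEqual N l) M))
                                      swapped-vanishes)
  where
  k<l′ : toℕ k ℕ.< toℕ (inject₁ l)
  k<l′ = subst (toℕ k ℕ.<_) (sym (toℕ-inject₁ l)) (ℕ.≤∧≢⇒< (ℕ.≤-pred k<l) k≢l)
  swapped-vanishes : det (swapCols (inject₁ l) (suc l) M) ≡ + 0
  swapped-vanishes = det-equalColumns< m _ k (inject₁ l) (trans (toℕ-inject₁ l) (ℕ.suc-injective l≡m)) k<l′ λ i →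
    trans (swapCols-off M i (λ k≡ → k≢l (trans (cong toℕ k≡) (toℕ-inject₁ l))) (λ k≡ → ℕ.<⇒≢ k<l (cong toℕ k≡)))
          (trans (Mₖ≡Mₗ i) (sym (swapCols-at₁ (inject₁ l) (suc l) M i)))

det-alternating : ∀ {n} (M : Mat n) {k l} → k ≢ l → (∀ i → M i k ≡ M i l) → det M ≡ + 0
det-alternating M {k} {l} k≢l Mₖ≡Mₗ with ℕ.<-cmp (toℕ k) (toℕ l)
... | tri< k<l _ _ = det-equalColumns< (toℕ l) M k l refl k<l Mₖ≡Mₗ
... | tri≈ _ k≡l _ = ⊥-elim (k≢l (toℕ-injective k≡l))
... | tri> _ _ l<k = det-equalColumns< (toℕ k) M l k refl l<k (sym ∘ Mₖ≡Mₗ)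

-- Alternating multilinear forms and multiplicativity of the determinant

record IsAlternatingMultilinear {n} (D : Mat n → ℤ) : Set where
  field
    resp-≋      : ∀ {M N} → M ≋ N → D M ≡ D N
    linear      : ColumnLinear D
    alternating : ∀ M {k l} → k ≢ l → (∀ i → M i k ≡ M i l) → D M ≡ + 0

det-isAlternatingMultilinear : ∀ {n} → IsAlternatingMultilinear (det {n})
det-isAlternatingMultilinear = record { resp-≋ = det-cong ; linear = det-linear ; alternating = det-alternating }

idMat : ∀ {n} → Mat n
idMat zero    zero    = + 1
idMat zero    (suc _) = + 0
idMat (suc _) zero    = + 0
idMat (suc i) (suc j) = idMat i j

idMat-diag : ∀ {n} (i : Fin n) → idMat i i ≡ + 1
idMat-diag zero    = refl
idMat-diag (suc i) = idMat-diag i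

idMat-offDiag : ∀ {n} {i j : Fin n} → i ≢ j → idMat i j ≡ + 0
idMat-offDiag {i = zero}  {zero}  i≢j = ⊥-elim (i≢j refl)
idMat-offDiag {i = zero}  {suc j} i≢j = refl
idMat-offDiag {i = suc i} {zero}  i≢j = refl
idMat-offDiag {i = suc i} {suc j} i≢j = idMat-offDiag (i≢j ∘ cong suc)

idMat-punchIn : ∀ {n} (i : Fin (suc n)) a b → idMat (punchIn i a) (punchIn i b) ≡ idMat a b
idMat-punchIn zero    a       b       = refl
idMat-punchIn (suc i) zero    zero    = refl
idMat-punchIn (suc i) zero    (suc b) = refl
idMat-punchIn (suc i) (suc a) zero    = refl
idMat-punchIn (suc i) (suc a) (suc b) = idMat-punchIn i a b

unitCol : ∀ {n} → Fin n → Fin n → ℤ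
unitCol t r = idMat r t

infixl 7 _·_
_·_ : ∀ {n} → Mat n → Mat n → Mat n
(A · B) i k = ∑ (λ j → A i j * B j k)

·-identityʳ : ∀ {n} (A : Mat n) → A · idMat ≋ A
·-identityʳ A i k = begin
  ∑ (λ j → A i j * idMat j k)   ≡⟨ ∑-single _ k (λ j j≢k → trans (cong (A i j *_) (idMat-offDiag j≢k)) (ℤ.*-zeroʳ (A i j))) ⟩
  A i k * idMat k k             ≡⟨ cong (A i k *_) (idMat-diag k) ⟩
  A i k * + 1                   ≡⟨ ℤ.*-identityʳ (A i k) ⟩
  A i k                         ∎

∑-idMat-* : ∀ {n} i (x : Fin n → ℤ) → ∑ (λ v → idMat i v * x v) ≡ x i
∑-idMat-* i x = begin
  ∑ (λ v → idMat i v * x v)  ≡⟨ ∑-single _ i (λ v v≢i → cong (_* x v) (idMat-offDiag (v≢i ∘ sym))) ⟩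
  idMat i i * x i            ≡⟨ cong (_* x i) (idMat-diag i) ⟩
  + 1 * x i                  ≡⟨ ℤ.*-identityˡ (x i) ⟩
  x i                        ∎

det-row₀-single : ∀ {n} (M : Mat (suc n)) k → (∀ j → j ≢ k → M zero j ≡ + 0) →
  det M ≡ sgn (toℕ k) * M zero k * det (minor k M)
det-row₀-single M k M₀ⱼ≡0 = ∑-single (cofactorTerm M) k λ j j≢k →
  trans (cong (λ a → sgn (toℕ j) * a * det (minor j M)) (M₀ⱼ≡0 j j≢k))
        (trans (cong (_* det (minor j M)) (ℤ.*-zeroʳ (sgn (toℕ j)))) (ℤ.*-zeroˡ (det (minor j M))))

det-idMat : ∀ {n} → det (idMat {n}) ≡ + 1
det-idMat {zero}  = refl
det-idMat {suc n} = begin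
  det (idMat {suc n})        ≡⟨ det-row₀-single (idMat {suc n}) zero (λ { zero 0≢0 → ⊥-elim (0≢0 refl) ; (suc j) _ → refl }) ⟩
  + 1 * det (idMat {n})      ≡⟨ ℤ.*-identityˡ (det (idMat {n})) ⟩
  det (idMat {n})            ≡⟨ det-idMat {n} ⟩
  + 1                        ∎

infixr 5 _∷ᶜ_
_∷ᶜ_ : ∀ {n} → (Fin (suc n) → ℤ) → (Fin (suc n) → Fin n → ℤ) → Mat (suc n)
(v ∷ᶜ X) r zero    = v r
(v ∷ᶜ X) r (suc c) = X r c

∷ᶜ-≋-off-zero : ∀ {n} (v w : Fin (suc n) → ℤ) X → (v ∷ᶜ X) ≋ (w ∷ᶜ X) off zero
∷ᶜ-≋-off-zero v w X r zero    0≢0 = ⊥-elim (0≢0 refl)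
∷ᶜ-≋-off-zero v w X r (suc c) _   = refl

linear-∑-column₀ : ∀ {n} {D : Mat (suc n) → ℤ} → ColumnLinear D →
  ∀ {m} (w : Fin m → ℤ) (f : Fin m → Fin (suc n) → ℤ) X →
  D ((λ r → ∑ (λ t → w t * f t r)) ∷ᶜ X) ≡ ∑ (λ t → w t * D (f t ∷ᶜ X))
linear-∑-column₀ lin {zero}  w f X = linear-zeroColumn lin _ zero λ _ → refl
linear-∑-column₀ {D = D} lin {suc m} w f X =
  trans (lin zero (w zero) _ _ _ (∷ᶜ-≋-off-zero _ (f zero) X) (∷ᶜ-≋-off-zero _ _ X) λ _ → refl)
        (cong (_+_ (w zero * D (f zero ∷ᶜ X))) (linear-∑-column₀ lin (w ∘ suc) (f ∘ suc) X))

restrictBelow : ∀ {n} → ℕ → (Fin n → ℤ) → Fin n → ℤ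
restrictBelow zero    t c = + 0
restrictBelow (suc m) t c with toℕ c ℕ.≟ m
... | yes _ = t c
... | no  _ = restrictBelow m t c

restrictBelow-≥ : ∀ {n} m (t : Fin n → ℤ) c → m ℕ.≤ toℕ c → restrictBelow m t c ≡ + 0
restrictBelow-≥ zero    t c _ = refl
restrictBelow-≥ (suc m) t c m<c with toℕ c ℕ.≟ m
... | yes c≡m = ⊥-elim (ℕ.<-irrefl (sym c≡m) m<c)
... | no  _   = restrictBelow-≥ m t c (ℕ.<⇒≤ m<c)

restrictBelow-< : ∀ {n} m (t : Fin n → ℤ) c → toℕ c ℕ.< m → restrictBelow m t c ≡ t c
restrictBelow-< (suc m) t c c<1+m with toℕ c ℕ.≟ m
... | yes _   = refl
... | no  c≢m = restrictBelow-< m t c (ℕ.≤∧≢⇒< (ℕ.≤-pred c<1+m) c≢m)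

insertZeroRow : ∀ {n m} → Fin (suc n) → (Fin n → Fin m → ℤ) → Fin (suc n) → Fin m → ℤ
insertZeroRow i Y r c with i Fin.≟ r
... | yes _   = + 0
... | no  i≢r = Y (punchOut i≢r) c

insertZeroRow-preserves : ∀ {n m} (R : ℤ → ℤ → Set) i (Y Y′ : Fin n → Fin m → ℤ) c c′ →
  R (+ 0) (+ 0) → (∀ r → R (Y r c) (Y′ r c′)) → ∀ r → R (insertZeroRow i Y r c) (insertZeroRow i Y′ r c′)
insertZeroRow-preserves R i Y Y′ c c′ R₀ RY r with i Fin.≟ r
... | yes _   = R₀
... | no  i≢r = RY (punchOut i≢r)

columnToFront : ∀ {n} → Fin (suc n) → Mat (suc n)
columnToFront i = unitCol i ∷ᶜ λ r c → idMat r (punchIn i c)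

insertZeroRow-idMat : ∀ {n} (i : Fin (suc n)) → (unitCol i ∷ᶜ insertZeroRow i idMat) ≋ columnToFront i
insertZeroRow-idMat i r zero = refl
insertZeroRow-idMat i r (suc c) with i Fin.≟ r
... | yes refl = sym (idMat-offDiag (punchInᵢ≢i i c ∘ sym))
... | no  i≢r  = sym (trans (cong (λ r′ → idMat r′ (punchIn i c)) (sym (punchIn-punchOut i≢r))) (idMat-punchIn i _ c))

minorColumn₀ : ∀ {n} → Fin (suc n) → Mat (suc n) → Mat n
minorColumn₀ i M r c = M (punchIn i r) (suc c)

detColumn₀ : ∀ {n} → Mat (suc n) → ℤ
detColumn₀ M = ∑ (λ i → sgn (toℕ i) * M i zero * det (minorColumn₀ i M))

module _ {n} {D : Mat n → ℤ} (isAM : IsAlternatingMultilinear D) where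
  open IsAlternatingMultilinear isAM

  addColumnMultiple : ∀ {a b} → a ≢ b → ∀ s (M N : Mat n) → M ≋ N off b →
    (∀ i → M i b ≡ s * N i a + N i b) → D M ≡ D N
  addColumnMultiple {a} {b} a≢b s M N M≋N Mᵦ = begin
    D M            ≡⟨ linear b s M N′ N (λ i j j≢b → trans (M≋N i j j≢b) (sym (replaceCol-off _ N i j≢b))) M≋N
                         (λ i → trans (Mᵦ i) (cong (λ x → s * x + N i b) (sym (replaceCol-at b (column N a) N i)))) ⟩
    s * D N′ + D N ≡⟨ cong (λ x → s * x + D N) (alternating N′ a≢b λ i → trans (replaceCol-off _ N i a≢b) (sym (replaceCol-at b _ N i))) ⟩
    s * + 0 + D N  ≡⟨ cong (_+ D N) (ℤ.*-zeroʳ s) ⟩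
    + 0 + D N      ≡⟨ ℤ.+-identityˡ (D N) ⟩
    D N            ∎
    where
    N′ = replaceCol b (column N a) N

column₀-expansion : ∀ {n} (M : Mat (suc n)) → M ≋ ((λ r → ∑ (λ t → M t zero * unitCol t r)) ∷ᶜ λ r c → M r (suc c))
column₀-expansion M r zero = sym (begin
  ∑ (λ t → M t zero * idMat r t) ≡⟨ ∑-single _ r (λ t t≢r → trans (cong (M t zero *_) (idMat-offDiag (t≢r ∘ sym))) (ℤ.*-zeroʳ (M t zero))) ⟩
  M r zero * idMat r r           ≡⟨ cong (M r zero *_) (idMat-diag r) ⟩
  M r zero * + 1                 ≡⟨ ℤ.*-identityʳ (M r zero) ⟩
  M r zero                       ∎)
column₀-expansion M r (suc c) = refl

clearRow-by-unitCol : ∀ {n} (M : Mat (suc n)) t →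
  (unitCol t ∷ᶜ λ r c → - M t (suc c) * unitCol t r + M r (suc c)) ≋ (unitCol t ∷ᶜ insertZeroRow t (minorColumn₀ t M))
clearRow-by-unitCol M t r zero = refl
clearRow-by-unitCol M t r (suc c) with t Fin.≟ r
... | yes refl = begin
  - M t (suc c) * idMat t t + M t (suc c)  ≡⟨ cong (λ e → - M t (suc c) * e + M t (suc c)) (idMat-diag t) ⟩
  - M t (suc c) * + 1 + M t (suc c)        ≡⟨ cong (_+ M t (suc c)) (ℤ.*-identityʳ (- M t (suc c))) ⟩
  - M t (suc c) + M t (suc c)              ≡⟨ ℤ.+-inverseˡ (M t (suc c)) ⟩
  + 0                                      ∎
... | no  t≢r  = begin
  - M t (suc c) * idMat r t + M r (suc c)  ≡⟨ cong (λ e → - M t (suc c) * e + M r (suc c)) (idMat-offDiag (t≢r ∘ sym)) ⟩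
  - M t (suc c) * + 0 + M r (suc c)        ≡⟨ cong (_+ M r (suc c)) (ℤ.*-zeroʳ (- M t (suc c))) ⟩
  + 0 + M r (suc c)                        ≡⟨ ℤ.+-identityˡ (M r (suc c)) ⟩
  M r (suc c)                              ≡⟨ cong (λ r′ → M r′ (suc c)) (punchIn-punchOut t≢r) ⟨
  M (punchIn t (punchOut t≢r)) (suc c)     ∎

module _ {n} {D : Mat (suc n) → ℤ} (isAM : IsAlternatingMultilinear D) where
  open IsAlternatingMultilinear isAM

  addColumn₀Multiples : ∀ v X (t : Fin n → ℤ) → D (v ∷ᶜ X) ≡ D (v ∷ᶜ λ r c → t c * v r + X r c)
  addColumn₀Multiples v X t = trans (prefix n ℕ.≤-refl) (resp-≋ λ where
      r zero    → refl
      r (suc c) → cong (λ s → s * v r + X r c) (restrictBelow-< n t c (toℕ<n c)))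
    where
    Z : ℕ → Mat (suc n)
    Z m = v ∷ᶜ λ r c → restrictBelow m t c * v r + X r c
    prefix : ∀ m → m ℕ.≤ n → D (v ∷ᶜ X) ≡ D (Z m)
    prefix zero _ = resp-≋ λ where
      r zero    → refl
      r (suc c) → sym (ℤ.+-identityˡ (X r c))
    prefix (suc m) m<n = trans (prefix m (ℕ.<⇒≤ m<n)) (sym (addColumnMultiple isAM {zero} {suc c₀} (λ ()) (t c₀) (Z (suc m)) (Z m) off at))
      where
      c₀ = Fin.fromℕ< m<n
      off : Z (suc m) ≋ Z m off suc c₀
      off r zero _ = refl
      off r (suc c) c≢c₀ with toℕ c ℕ.≟ m
      ... | yes c≡m = ⊥-elim (c≢c₀ (cong suc (toℕ-injective (trans c≡m (sym (toℕ-fromℕ< m<n))))))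
      ... | no  _   = refl
      at : ∀ r → Z (suc m) r (suc c₀) ≡ t c₀ * v r + Z m r (suc c₀)
      at r with toℕ c₀ ℕ.≟ m
      ... | no  c₀≢m = ⊥-elim (c₀≢m (toℕ-fromℕ< m<n))
      ... | yes c₀≡m = cong (_+_ (t c₀ * v r)) (sym (trans
            (cong (λ s → s * v r + X r c₀) (restrictBelow-≥ m t c₀ (ℕ.≤-reflexive (sym c₀≡m)))) (ℤ.+-identityˡ (X r c₀))))

  restrictedForm : Fin (suc n) → Mat n → ℤ
  restrictedForm i Y = D (unitCol i ∷ᶜ insertZeroRow i Y)

  restrictedForm-isAlternatingMultilinear : ∀ i → IsAlternatingMultilinear (restrictedForm i)
  restrictedForm-isAlternatingMultilinear i = record
    { resp-≋      = λ Y≋Y′ → resp-≋ λ where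
        r zero    → refl
        r (suc c) → insertZeroRow-preserves _≡_ i _ _ c c refl (λ r′ → Y≋Y′ r′ c) r
    ; linear      = λ k c Y N P Y≋N Y≋P Yₖ → linear (suc k) c (unitCol i ∷ᶜ insertZeroRow i Y) (unitCol i ∷ᶜ insertZeroRow i N) (unitCol i ∷ᶜ insertZeroRow i P)
        (off Y≋N) (off Y≋P) (at {k} {c} {Y} {N} {P} Yₖ)
    ; alternating = λ Y k≢l Yₖ≡Yₗ → alternating _ (k≢l ∘ suc-injective) (insertZeroRow-preserves _≡_ i Y Y _ _ refl Yₖ≡Yₗ)
    }
    where
    off : ∀ {k} {Y N : Mat n} → Y ≋ N off k → (unitCol i ∷ᶜ insertZeroRow i Y) ≋ (unitCol i ∷ᶜ insertZeroRow i N) off suc k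
    off Y≋N r zero    _      = refl
    off Y≋N r (suc j) j+1≢k+1 = insertZeroRow-preserves _≡_ i _ _ j j refl (λ r′ → Y≋N r′ j (j+1≢k+1 ∘ cong suc)) r
    at : ∀ {k c} {Y N P : Mat n} → (∀ r → Y r k ≡ c * N r k + P r k) →
      ∀ r → insertZeroRow i Y r k ≡ c * insertZeroRow i N r k + insertZeroRow i P r k
    at {c = c} Yₖ r with i Fin.≟ r
    ... | yes _   = sym (trans (ℤ.+-identityʳ (c * + 0)) (ℤ.*-zeroʳ c))
    ... | no  i≢r = Yₖ (punchOut i≢r)

  columnToFront-sign : ∀ m i → toℕ i ≡ m → D (columnToFront i) ≡ sgn m * D idMat
  columnToFront-sign zero zero _ = trans (resp-≋ toIdentity) (sym (ℤ.*-identityˡ (D idMat)))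
    where
    toIdentity : columnToFront zero ≋ idMat
    toIdentity r zero    = refl
    toIdentity r (suc c) = refl
  columnToFront-sign (suc m) (suc i) 1+i≡1+m = begin
    D (columnToFront (suc i))                 ≡⟨ ℤ.neg-involutive _ ⟨
    - - D (columnToFront (suc i))             ≡⟨ cong -_ (swapCols-negates resp-≋ linear (λ ()) (λ N → alternating N (λ ())) _) ⟨
    - D (swapCols zero (suc i) (columnToFront (suc i))) ≡⟨ cong -_ (resp-≋ swapped) ⟩
    - D (columnToFront (inject₁ i))           ≡⟨ cong -_ (columnToFront-sign m (inject₁ i) (trans (toℕ-inject₁ i) (ℕ.suc-injective 1+i≡1+m))) ⟩
    - (sgn m * D idMat)                       ≡⟨ ℤ.neg-distribˡ-* (sgn m) (D idMat) ⟩
    sgn (suc m) * D idMat                     ∎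
    where
    swapped : swapCols zero (suc i) (columnToFront (suc i)) ≋ columnToFront (inject₁ i)
    swapped r zero = trans (swapCols-at₁ zero (suc i) (columnToFront (suc i)) r) (cong (idMat r) (punchIn-suc-diag i))
    swapped r (suc c) = swappedColumn (c Fin.≟ i)
      where
      swappedColumn : Dec (c ≡ i) → swapCols zero (suc i) (columnToFront (suc i)) r (suc c) ≡ columnToFront (inject₁ i) r (suc c)
      swappedColumn (yes c≡i) rewrite c≡i =
        trans (swapCols-at₂ {a = zero} {suc i} (columnToFront (suc i)) r (λ ())) (cong (idMat r) (sym (punchIn-inject₁-diag i)))
      swappedColumn (no c≢i) =
        trans (swapCols-off {a = zero} {suc i} {suc c} (columnToFront (suc i)) r (λ ()) (c≢i ∘ suc-injective))
              (cong (idMat r) (sym (punchIn-inject₁≡punchIn-suc c≢i)))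

  expandColumn₀ : (∀ {D′ : Mat n → ℤ} → IsAlternatingMultilinear D′ → ∀ Y → D′ Y ≡ det Y * D′ idMat) →
    ∀ M → D M ≡ detColumn₀ M * D idMat
  expandColumn₀ unique M = begin
    D M                                                      ≡⟨ resp-≋ (column₀-expansion M) ⟩
    D ((λ r → ∑ (λ t → M t zero * unitCol t r)) ∷ᶜ X)        ≡⟨ linear-∑-column₀ linear (λ t → M t zero) unitCol X ⟩
    ∑ (λ t → M t zero * D (unitCol t ∷ᶜ X))                  ≡⟨ ∑-cong term ⟩
    ∑ (λ t → sgn (toℕ t) * M t zero * det (minorColumn₀ t M) * D idMat)
                                                             ≡⟨ *-distribʳ-∑ (D idMat) (λ t → sgn (toℕ t) * M t zero * det (minorColumn₀ t M)) ⟨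
    detColumn₀ M * D idMat                                   ∎
    where
    X : Fin (suc n) → Fin n → ℤ
    X r c = M r (suc c)
    unitColumn : ∀ t → D (unitCol t ∷ᶜ X) ≡ det (minorColumn₀ t M) * (sgn (toℕ t) * D idMat)
    unitColumn t = begin
      D (unitCol t ∷ᶜ X)                                     ≡⟨ addColumn₀Multiples (unitCol t) X (λ c → - X t c) ⟩
      D (unitCol t ∷ᶜ λ r c → - X t c * unitCol t r + X r c) ≡⟨ resp-≋ (clearRow-by-unitCol M t) ⟩
      restrictedForm t (minorColumn₀ t M)                    ≡⟨ unique (restrictedForm-isAlternatingMultilinear t) _ ⟩
      det (minorColumn₀ t M) * restrictedForm t idMat        ≡⟨ cong (det (minorColumn₀ t M) *_) (resp-≋ (insertZeroRow-idMat t)) ⟩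
      det (minorColumn₀ t M) * D (columnToFront t)           ≡⟨ cong (det (minorColumn₀ t M) *_) (columnToFront-sign (toℕ t) t refl) ⟩
      det (minorColumn₀ t M) * (sgn (toℕ t) * D idMat)       ∎
    rearrange : ∀ a d s x → a * (d * (s * x)) ≡ s * a * d * x
    rearrange = solve-∀
    term : ∀ t → M t zero * D (unitCol t ∷ᶜ X) ≡ sgn (toℕ t) * M t zero * det (minorColumn₀ t M) * D idMat
    term t = trans (cong (M t zero *_) (unitColumn t)) (rearrange (M t zero) (det (minorColumn₀ t M)) (sgn (toℕ t)) (D idMat))

alternatingMultilinear-unique : ∀ {n} {D : Mat n → ℤ} → IsAlternatingMultilinear D → ∀ M → D M ≡ det M * D idMat
alternatingMultilinear-unique {zero} isAM M =
  trans (IsAlternatingMultilinear.resp-≋ isAM λ ()) (sym (ℤ.*-identityˡ _))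
alternatingMultilinear-unique {suc n} {D} isAM M = begin
  D M                     ≡⟨ expandColumn₀ isAM alternatingMultilinear-unique M ⟩
  detColumn₀ M * D idMat  ≡⟨ cong (_* D idMat) det≡detColumn₀ ⟨
  det M * D idMat         ∎
  where
  det≡detColumn₀ : det M ≡ detColumn₀ M
  det≡detColumn₀ = begin
    det M                        ≡⟨ expandColumn₀ det-isAlternatingMultilinear alternatingMultilinear-unique M ⟩
    detColumn₀ M * det (idMat {suc n}) ≡⟨ cong (detColumn₀ M *_) (det-idMat {suc n}) ⟩
    detColumn₀ M * + 1           ≡⟨ ℤ.*-identityʳ _ ⟩
    detColumn₀ M                 ∎

det-·ˡ-isAlternatingMultilinear : ∀ {n} (A : Mat n) → IsAlternatingMultilinear (λ B → det (A · B))
det-·ˡ-isAlternatingMultilinear A = record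
  { resp-≋      = λ {M} {N} M≋N → det-cong λ i k → ·-cong M N k k (λ t → M≋N t k) i
  ; linear      = λ k c M N P M≋N M≋P Mₖ → det-linear k c _ _ _
      (λ i j j≢k → ·-cong M N j j (λ t → M≋N t j j≢k) i) (λ i j j≢k → ·-cong M P j j (λ t → M≋P t j j≢k) i) λ i → begin
        ∑ (λ t → A i t * M t k)                           ≡⟨ ∑-cong (λ t → trans (cong (A i t *_) (Mₖ t)) (distrib (A i t) c (N t k) (P t k))) ⟩
        ∑ (λ t → c * (A i t * N t k) + A i t * P t k)     ≡⟨ ∑-distrib-+ (λ t → c * (A i t * N t k)) _ ⟩
        ∑ (λ t → c * (A i t * N t k)) + (A · P) i k       ≡⟨ cong (_+ (A · P) i k) (*-distribˡ-∑ c (λ t → A i t * N t k)) ⟨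
        c * (A · N) i k + (A · P) i k                     ∎
  ; alternating = λ M k≢l Mₖ≡Mₗ → det-alternating _ k≢l (·-cong M M _ _ Mₖ≡Mₗ)
  }
  where
  ·-cong : ∀ M N k l → (∀ t → M t k ≡ N t l) → ∀ i → (A · M) i k ≡ (A · N) i l
  ·-cong M N k l Mₖ≡Nₗ i = ∑-cong λ t → cong (A i t *_) (Mₖ≡Nₗ t)
  distrib : ∀ a c x y → a * (c * x + y) ≡ c * (a * x) + a * y
  distrib = solve-∀

det-· : ∀ {n} (A B : Mat n) → det (A · B) ≡ det A * det B
det-· A B = begin
  det (A · B)              ≡⟨ alternatingMultilinear-unique (det-·ˡ-isAlternatingMultilinear A) B ⟩
  det B * det (A · idMat)  ≡⟨ cong (det B *_) (det-cong (·-identityʳ A)) ⟩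
  det B * det A            ≡⟨ ℤ.*-comm (det B) (det A) ⟩
  det A * det B            ∎

UpperTriangular : ∀ {n} → Mat n → Set
UpperTriangular {n} U = ∀ (i j : Fin n) → toℕ j ℕ.< toℕ i → U i j ≡ + 0

det-minor-zeroColumn₀ : ∀ {n} (M : Mat (suc n)) → (∀ r → M (suc r) zero ≡ + 0) → ∀ j → det (minor (suc j) M) ≡ + 0
det-minor-zeroColumn₀ {suc n} M M₀ j = linear-zeroColumn det-linear (minor (suc j) M) zero M₀

det-column₀-zeroBelow : ∀ {n} (M : Mat (suc n)) → (∀ r → M (suc r) zero ≡ + 0) →
  det M ≡ M zero zero * det (minor zero M)
det-column₀-zeroBelow M M₀ = begin
  det M                                  ≡⟨ ∑-single (cofactorTerm M) zero otherTerms ⟩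
  + 1 * M zero zero * det (minor zero M) ≡⟨ cong (_* det (minor zero M)) (ℤ.*-identityˡ (M zero zero)) ⟩
  M zero zero * det (minor zero M)       ∎
  where
  otherTerms : ∀ j → j ≢ zero → cofactorTerm M j ≡ + 0
  otherTerms zero    0≢0 = ⊥-elim (0≢0 refl)
  otherTerms (suc j) _   = trans (cong (sgn (toℕ (suc j)) * M zero (suc j) *_) (det-minor-zeroColumn₀ M M₀ j))
                                 (ℤ.*-zeroʳ (sgn (toℕ (suc j)) * M zero (suc j)))

∣det∣-upperTriangular : ∀ {n} (U : Mat n) → UpperTriangular U → (∀ i → ∣ U i i ∣ ≡ 1) → ∣ det U ∣ ≡ 1
∣det∣-upperTriangular {zero}  U upper diag = refl
∣det∣-upperTriangular {suc n} U upper diag = begin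
  ∣ det U ∣                                   ≡⟨ cong ∣_∣ (det-column₀-zeroBelow U λ r → upper (suc r) zero (ℕ.s≤s ℕ.z≤n)) ⟩
  ∣ U zero zero * det (minor zero U) ∣        ≡⟨ ℤ.abs-* (U zero zero) (det (minor zero U)) ⟩
  ∣ U zero zero ∣ ℕ.* ∣ det (minor zero U) ∣  ≡⟨ cong₂ ℕ._*_ (diag zero) (∣det∣-upperTriangular (minor zero U) upper′ (diag ∘ suc)) ⟩
  1                                           ∎
  where
  upper′ : UpperTriangular (minor zero U)
  upper′ i j j<i = upper (suc i) (suc j) (ℕ.s≤s j<i)

∣det∣-·-upperTriangular : ∀ {n} (M U : Mat n) → UpperTriangular U → (∀ i → ∣ U i i ∣ ≡ 1) →
  ∣ det (M · U) ∣ ≡ ∣ det M ∣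
∣det∣-·-upperTriangular M U upper diag = begin
  ∣ det (M · U) ∣            ≡⟨ cong ∣_∣ (det-· M U) ⟩
  ∣ det M * det U ∣          ≡⟨ ℤ.abs-* (det M) (det U) ⟩
  ∣ det M ∣ ℕ.* ∣ det U ∣    ≡⟨ cong (∣ det M ∣ ℕ.*_) (∣det∣-upperTriangular U upper diag) ⟩
  ∣ det M ∣ ℕ.* 1            ≡⟨ ℕ.*-identityʳ ∣ det M ∣ ⟩
  ∣ det M ∣                  ∎

∣sgn∣ : ∀ k → ∣ sgn k ∣ ≡ 1
∣sgn∣ zero    = refl
∣sgn∣ (suc k) = trans (ℤ.∣-i∣≡∣i∣ (sgn k)) (∣sgn∣ k)

infix 4 _≐_
_≐_ : ∀ {n} → Graph n → Graph n → Set
g ≐ h = ∀ i j → g i j ≡ h i j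

Loopless : ∀ {n} → Graph n → Set
Loopless g = ∀ i → g i i ≡ false

adjMat-cong : ∀ {n} {g h : Graph n} → g ≐ h → adjMat g ≋ adjMat h
adjMat-cong g≐h i j = cong (λ b → if b then + 1 else + 0) (g≐h i j)

walkVec-cong : ∀ {n} {A B : Mat n} → A ≋ B → ∀ k i → walkVec A k i ≡ walkVec B k i
walkVec-cong A≋B zero    i = refl
walkVec-cong A≋B (suc k) i = ∑-cong λ j → cong₂ _*_ (A≋B i j) (walkVec-cong A≋B k j)

mul-walkCombination : ∀ {n} (A : Mat n) m (c : ℕ → ℤ) (x : Fin n → ℤ) →
  (∀ v → x v ≡ ∑ {m} (λ j → c (toℕ j) * walkVec A (toℕ j) v)) →
  ∀ i → ∑ (λ v → A i v * x v) ≡ ∑ {m} (λ j → c (toℕ j) * walkVec A (suc (toℕ j)) i)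
mul-walkCombination {n} A m c x x≡∑ i = begin
  ∑ (λ v → A i v * x v)                                            ≡⟨ ∑-cong (λ v → cong (A i v *_) (x≡∑ v)) ⟩
  ∑ (λ v → A i v * ∑ {m} (λ j → c (toℕ j) * walkVec A (toℕ j) v))  ≡⟨ ∑-cong (λ v → trans (*-distribˡ-∑ {m} (A i v) (λ j → c (toℕ j) * walkVec A (toℕ j) v))
                                                                          (∑-cong {m} λ j → reassoc (A i v) (c (toℕ j)) (walkVec A (toℕ j) v))) ⟩
  ∑ (λ v → ∑ {m} (λ j → c (toℕ j) * (A i v * walkVec A (toℕ j) v))) ≡⟨ ∑-comm {n} {m} (λ v j → c (toℕ j) * (A i v * walkVec A (toℕ j) v)) ⟩
  ∑ {m} (λ j → ∑ (λ v → c (toℕ j) * (A i v * walkVec A (toℕ j) v))) ≡⟨ ∑-cong {m} (λ j → *-distribˡ-∑ (c (toℕ j)) (λ v → A i v * walkVec A (toℕ j) v)) ⟨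
  ∑ {m} (λ j → c (toℕ j) * walkVec A (suc (toℕ j)) i)              ∎
  where
  reassoc : ∀ a b y → a * (b * y) ≡ b * (a * y)
  reassoc = solve-∀

walkMat-cong : ∀ {n} {g h : Graph n} → g ≐ h → walkMat g ≋ walkMat h
walkMat-cong g≐h i k = walkVec-cong (adjMat-cong g≐h) (toℕ k) i

addCone-cong : ∀ {n} {g h : Graph n} → g ≐ h → addCone g ≐ addCone h
addCone-cong g≐h zero    zero    = refl
addCone-cong g≐h zero    (suc j) = refl
addCone-cong g≐h (suc i) zero    = refl
addCone-cong g≐h (suc i) (suc j) = g≐h i j

complement-addIsolated : ∀ {n} (g : Graph n) → complement (addIsolated g) ≐ addCone (complement g)
complement-addIsolated g zero    zero    = refl
complement-addIsolated g zero    (suc j) = refl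
complement-addIsolated g (suc i) zero    = refl
complement-addIsolated g (suc i) (suc j) with i Fin.≟ j
... | yes _ = refl
... | no  _ = refl

complement-addCone : ∀ {n} (g : Graph n) → complement (addCone g) ≐ addIsolated (complement g)
complement-addCone g zero    zero    = refl
complement-addCone g zero    (suc j) = refl
complement-addCone g (suc i) zero    = refl
complement-addCone g (suc i) (suc j) with i Fin.≟ j
... | yes _ = refl
... | no  _ = refl

addIsolated-loopless : ∀ {n} {g : Graph n} → Loopless g → Loopless (addIsolated g)
addIsolated-loopless loopless zero    = refl
addIsolated-loopless loopless (suc i) = loopless i

addCone-loopless : ∀ {n} {g : Graph n} → Loopless g → Loopless (addCone g)
addCone-loopless loopless zero    = refl
addCone-loopless loopless (suc i) = loopless i

walkVec-addIsolated-old : ∀ {n} (g : Graph n) k r → walkVec (adjMat (addIsolated g)) k (suc r) ≡ walkVec (adjMat g) k r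
walkVec-addIsolated-old g zero    r = refl
walkVec-addIsolated-old g (suc k) r = trans (ℤ.+-identityˡ _) (∑-cong λ j → cong (adjMat g r j *_) (walkVec-addIsolated-old g k j))

walkVec-addIsolated-new : ∀ {n} (g : Graph n) k → walkVec (adjMat (addIsolated g)) (suc k) zero ≡ + 0
walkVec-addIsolated-new g k = ∑-zero {f = λ j → adjMat (addIsolated g) zero j * walkVec (adjMat (addIsolated g)) k j} λ { zero → refl ; (suc j) → refl }

det-walkMat-addIsolated : ∀ {n} (g : Graph n) → det (walkMat (addIsolated g)) ≡ det (adjMat g) * det (walkMat g)
det-walkMat-addIsolated g = begin
  det (walkMat (addIsolated g))                    ≡⟨ det-row₀-single (walkMat (addIsolated g)) zero firstRow ⟩
  + 1 * det (minor zero (walkMat (addIsolated g))) ≡⟨ ℤ.*-identityˡ (det (minor zero (walkMat (addIsolated g)))) ⟩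
  det (minor zero (walkMat (addIsolated g)))       ≡⟨ det-cong (λ r c → walkVec-addIsolated-old g (suc (toℕ c)) r) ⟩
  det (adjMat g · walkMat g)                       ≡⟨ det-· (adjMat g) (walkMat g) ⟩
  det (adjMat g) * det (walkMat g)                 ∎
  where
  firstRow : ∀ j → j ≢ zero → walkMat (addIsolated g) zero j ≡ + 0
  firstRow zero    0≢0 = ⊥-elim (0≢0 refl)
  firstRow (suc j) _   = walkVec-addIsolated-new g (toℕ j)

det-minor-addCone-addIsolated : ∀ {n} (h : Graph n) (j : Fin n) →
  det (minor (suc (suc j)) (adjMat (addCone (addIsolated h)))) ≡ + 0
det-minor-addCone-addIsolated {suc n} h j =
  linear-zeroColumn det-linear (minor (suc (suc j)) (adjMat (addCone (addIsolated h)))) (suc zero) λ { zero → refl ; (suc r) → refl }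

det-adjMat-addCone-addIsolated : ∀ {n} (h : Graph n) → det (adjMat (addCone (addIsolated h))) ≡ - det (adjMat h)
det-adjMat-addCone-addIsolated h = begin
  det B                              ≡⟨ ∑-single (cofactorTerm B) (suc zero) otherTerms ⟩
  - + 1 * + 1 * det (minor (suc zero) B) ≡⟨ cong (- + 1 * + 1 *_) (det-row₀-single (minor (suc zero) B) zero uRow) ⟩
  - + 1 * + 1 * (+ 1 * det (adjMat h))  ≡⟨ sign (det (adjMat h)) ⟩
  - det (adjMat h)                   ∎
  where
  B = adjMat (addCone (addIsolated h))
  uRow : ∀ j → j ≢ zero → minor (suc zero) B zero j ≡ + 0
  uRow zero    0≢0 = ⊥-elim (0≢0 refl)
  uRow (suc j) _   = refl
  otherTerms : ∀ j → j ≢ suc zero → cofactorTerm B j ≡ + 0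
  otherTerms zero          _   = refl
  otherTerms (suc zero)    1≢1 = ⊥-elim (1≢1 refl)
  otherTerms (suc (suc j)) _   = trans (cong (sgn (toℕ (suc (suc j))) * + 1 *_) (det-minor-addCone-addIsolated h j))
                                       (ℤ.*-zeroʳ (sgn (toℕ (suc (suc j))) * + 1))
  sign : ∀ x → - + 1 * + 1 * (+ 1 * x) ≡ - x
  sign = solve-∀

-- The walk matrix of a complement

module _ {n} {g : Graph n} (loopless : Loopless g) where
  private
    A Ā : Mat n
    A = adjMat g
    Ā = adjMat (complement g)
    w w̄ : ℕ → Fin n → ℤ
    w = walkVec A
    w̄ = walkVec Ā

  adjMat-complement : ∀ i v → Ā i v ≡ + 1 + - idMat i v + - A i v
  adjMat-complement i v with i Fin.≟ v
  ... | yes refl rewrite loopless i | idMat-diag i = refl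
  ... | no  i≢v  rewrite idMat-offDiag i≢v with g i v
  ...   | true  = refl
  ...   | false = refl

  adjMat-complement-mul : ∀ (x : Fin n → ℤ) i → ∑ (λ v → Ā i v * x v) ≡ ∑ x + - x i + - ∑ (λ v → A i v * x v)
  adjMat-complement-mul x i = begin
    ∑ (λ v → Ā i v * x v)                                           ≡⟨ ∑-cong (λ v → trans (cong (_* x v) (adjMat-complement i v)) (expand (idMat i v) (A i v) (x v))) ⟩
    ∑ (λ v → x v + - (idMat i v * x v) + - (A i v * x v))           ≡⟨ ∑-distrib-+ (λ v → x v + - (idMat i v * x v)) (λ v → - (A i v * x v)) ⟩
    ∑ (λ v → x v + - (idMat i v * x v)) + ∑ (λ v → - (A i v * x v)) ≡⟨ cong₂ _+_ (∑-distrib-+ x (λ v → - (idMat i v * x v))) (sym (neg-distrib-∑ (λ v → A i v * x v))) ⟩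
    ∑ x + ∑ (λ v → - (idMat i v * x v)) + - ∑ (λ v → A i v * x v)   ≡⟨ cong (λ s → ∑ x + s + - ∑ (λ v → A i v * x v)) (neg-distrib-∑ (λ v → idMat i v * x v)) ⟨
    ∑ x + - ∑ (λ v → idMat i v * x v) + - ∑ (λ v → A i v * x v)     ≡⟨ cong (λ s → ∑ x + - s + - ∑ (λ v → A i v * x v)) (∑-idMat-* i x) ⟩
    ∑ x + - x i + - ∑ (λ v → A i v * x v)                           ∎
    where
    expand : ∀ d a y → (+ 1 + - d + - a) * y ≡ y + - (d * y) + - (a * y)
    expand = solve-∀

  -- Quantifying over every summation range m > k spares the inductive step any truncation of sums.
  record WalkExpansion (k : ℕ) : Set where
    field
      coeff   : ℕ → ℤ
      above   : ∀ j → k ℕ.< j → coeff j ≡ + 0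
      leading : coeff k ≡ sgn k
      expands : ∀ m → k ℕ.< m → ∀ i → w̄ k i ≡ ∑ {m} (λ j → coeff (toℕ j) * w (toℕ j) i)

  walkExpansion : ∀ k → WalkExpansion k
  walkExpansion zero = record
    { coeff   = λ { zero → + 1 ; (suc _) → + 0 }
    ; above   = λ { (suc j) _ → refl }
    ; leading = refl
    ; expands = λ { (suc m) _ i → sym (cong (_+_ (+ 1)) (∑-zero {m} λ _ → refl)) }
    }
  walkExpansion (suc k) = record { coeff = coeff′ ; above = above′ ; leading = leading′ ; expands = expands′ }
    where
    open WalkExpansion (walkExpansion k)
    σ = ∑ (w̄ k)
    coeff′ : ℕ → ℤ
    coeff′ zero    = σ + - coeff 0
    coeff′ (suc j) = - coeff (suc j) + - coeff j
    above′ : ∀ j → suc k ℕ.< j → coeff′ j ≡ + 0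
    above′ (suc j) (ℕ.s≤s k<j) rewrite above (suc j) (ℕ.m<n⇒m<1+n k<j) | above j k<j = refl
    leading′ : coeff′ (suc k) ≡ sgn (suc k)
    leading′ rewrite above (suc k) (ℕ.n<1+n k) | leading = ℤ.+-identityˡ (sgn (suc k))
    expands′ : ∀ m → suc k ℕ.< m → ∀ i → w̄ (suc k) i ≡ ∑ {m} (λ j → coeff′ (toℕ j) * w (toℕ j) i)
    expands′ (suc m) (ℕ.s≤s k<m) i = begin
      w̄ (suc k) i                                 ≡⟨ adjMat-complement-mul (w̄ k) i ⟩
      σ + - w̄ k i + - ∑ (λ v → A i v * w̄ k v)    ≡⟨ cong₂ (λ x y → σ + - x + - y) (expands (suc m) (ℕ.m<n⇒m<1+n k<m) i) shifted ⟩
      σ + - (coeff 0 * + 1 + P) + - Q             ≡⟨ regroup σ (coeff 0) P Q ⟩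
      (σ + - coeff 0) * + 1 + (- P + - Q)         ≡⟨ cong (_+_ ((σ + - coeff 0) * + 1)) split ⟨
      ∑ {suc m} (λ j → coeff′ (toℕ j) * w (toℕ j) i) ∎
      where
      P Q : ℤ
      P = ∑ {m} (λ j → coeff (suc (toℕ j)) * w (suc (toℕ j)) i)
      Q = ∑ {m} (λ j → coeff (toℕ j) * w (suc (toℕ j)) i)
      regroup : ∀ s c p q → s + - (c * + 1 + p) + - q ≡ (s + - c) * + 1 + (- p + - q)
      regroup = solve-∀
      shifted : ∑ (λ v → A i v * w̄ k v) ≡ Q
      shifted = mul-walkCombination A m (λ j → coeff j) (w̄ k) (expands m k<m) i
      split : ∑ {m} (λ j → coeff′ (suc (toℕ j)) * w (suc (toℕ j)) i) ≡ - P + - Q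
      split = ∑-neg-+-* {m} (λ j → coeff (suc (toℕ j))) (λ j → coeff (toℕ j)) (λ j → w (suc (toℕ j)) i)

  complementWalkCoeffs : Mat n
  complementWalkCoeffs j k = WalkExpansion.coeff (walkExpansion (toℕ k)) (toℕ j)

  walkMat-complement : walkMat (complement g) ≋ walkMat g · complementWalkCoeffs
  walkMat-complement i k = trans (WalkExpansion.expands (walkExpansion (toℕ k)) n (toℕ<n k) i)
                                 (∑-cong {n} λ j → ℤ.*-comm (complementWalkCoeffs j k) (w (toℕ j) i))

  ∣det-walkMat-complement∣ : ∣ det (walkMat (complement g)) ∣ ≡ ∣ det (walkMat g) ∣
  ∣det-walkMat-complement∣ = trans (cong ∣_∣ (det-cong walkMat-complement))
    (∣det∣-·-upperTriangular (walkMat g) complementWalkCoeffs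
      (λ j k k<j → WalkExpansion.above (walkExpansion (toℕ k)) (toℕ j) k<j)
      (λ k → trans (cong ∣_∣ (WalkExpansion.leading (walkExpansion (toℕ k)))) (∣sgn∣ (toℕ k))))

-- The alternating sequence

double : ℕ → ℕ
double zero    = zero
double (suc k) = suc (suc (double k))

isOdd-double : ∀ k → isOdd (double k) ≡ false
isOdd-double zero    = refl
isOdd-double (suc k) rewrite isOdd-double k = refl

seqG-odd : ∀ {n} (g : Graph n) k → seqG g (suc (double k)) ≡ addIsolated (seqG g (double k))
seqG-odd g k rewrite isOdd-double k = refl

seqG-even : ∀ {n} (g : Graph n) k → seqG g (double (suc k)) ≡ addCone (seqG g (suc (double k)))
seqG-even g k rewrite isOdd-double k = refl

seqG-twoSteps : ∀ {n} (g : Graph n) k → seqG g (double (suc k)) ≡ addCone (addIsolated (seqG g (double k)))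
seqG-twoSteps g k = trans (seqG-even g k) (cong addCone (seqG-odd g k))

seqG-loopless : ∀ {n} {g : Graph n} → Loopless g → ∀ i → Loopless (seqG g i)
seqG-loopless loopless zero    = loopless
seqG-loopless {g = g} loopless (suc i) = extension-loopless (isOdd (suc i))
  where
  extension-loopless : ∀ odd → Loopless (if odd then addIsolated (seqG g i) else addCone (seqG g i))
  extension-loopless true  = addIsolated-loopless (seqG-loopless loopless i)
  extension-loopless false = addCone-loopless (seqG-loopless loopless i)

module AlternatingExtensions {n} (G₀ : Graph n) (loopless : Loopless G₀) where
  a b p : ℕ
  a = ∣ det (adjMat G₀) ∣
  b = ∣ det (walkMat G₀) ∣
  p = ∣ det (adjMat (complement (seqG G₀ 1))) ∣

  ∣det-adjMat∣-even : ∀ k → ∣ det (adjMat (seqG G₀ (double k))) ∣ ≡ a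
  ∣det-adjMat∣-even zero    = refl
  ∣det-adjMat∣-even (suc k) = begin
    ∣ det (adjMat (seqG G₀ (double (suc k)))) ∣         ≡⟨ cong (λ h → ∣ det (adjMat h) ∣) (seqG-twoSteps G₀ k) ⟩
    ∣ det (adjMat (addCone (addIsolated E))) ∣         ≡⟨ cong ∣_∣ (det-adjMat-addCone-addIsolated E) ⟩
    ∣ - det (adjMat E) ∣                                ≡⟨ ℤ.∣-i∣≡∣i∣ (det (adjMat E)) ⟩
    ∣ det (adjMat E) ∣                                  ≡⟨ ∣det-adjMat∣-even k ⟩
    a                                                   ∎
    where
    E = seqG G₀ (double k)

  ∣det-adjMat-complement∣-odd : ∀ k → ∣ det (adjMat (complement (seqG G₀ (suc (double k))))) ∣ ≡ p
  ∣det-adjMat-complement∣-odd zero    = refl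
  ∣det-adjMat-complement∣-odd (suc k) = begin
    ∣ det (adjMat (complement (seqG G₀ (suc (double (suc k)))))) ∣ ≡⟨ cong (λ h → ∣ det (adjMat (complement h)) ∣) unfold ⟩
    ∣ det (adjMat (complement (addIsolated (addCone O)))) ∣        ≡⟨ cong ∣_∣ (det-cong (adjMat-cong complements)) ⟩
    ∣ det (adjMat (addCone (addIsolated (complement O)))) ∣        ≡⟨ cong ∣_∣ (det-adjMat-addCone-addIsolated (complement O)) ⟩
    ∣ - det (adjMat (complement O)) ∣                              ≡⟨ ℤ.∣-i∣≡∣i∣ (det (adjMat (complement O))) ⟩
    ∣ det (adjMat (complement O)) ∣                                ≡⟨ ∣det-adjMat-complement∣-odd k ⟩
    p                                                              ∎
    where
    O = seqG G₀ (suc (double k))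
    unfold : seqG G₀ (suc (double (suc k))) ≡ addIsolated (addCone O)
    unfold = trans (seqG-odd G₀ (suc k)) (cong addIsolated (seqG-even G₀ k))
    complements : complement (addIsolated (addCone O)) ≐ addCone (addIsolated (complement O))
    complements i j = trans (complement-addIsolated (addCone O) i j) (addCone-cong (complement-addCone O) i j)

  ∣det-walkMat∣-even : ∀ k → ∣ det (walkMat (seqG G₀ (double k))) ∣ ≡ a ℕ.^ k ℕ.* b ℕ.* p ℕ.^ k
  ∣det-walkMat∣-odd : ∀ k → ∣ det (walkMat (seqG G₀ (suc (double k)))) ∣ ≡ a ℕ.^ suc k ℕ.* b ℕ.* p ℕ.^ k

  ∣det-walkMat∣-odd k = begin
    ∣ det (walkMat (seqG G₀ (suc (double k)))) ∣         ≡⟨ cong (λ h → ∣ det (walkMat h) ∣) (seqG-odd G₀ k) ⟩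
    ∣ det (walkMat (addIsolated E)) ∣                    ≡⟨ cong ∣_∣ (det-walkMat-addIsolated E) ⟩
    ∣ det (adjMat E) * det (walkMat E) ∣                 ≡⟨ ℤ.abs-* (det (adjMat E)) (det (walkMat E)) ⟩
    ∣ det (adjMat E) ∣ ℕ.* ∣ det (walkMat E) ∣           ≡⟨ cong₂ ℕ._*_ (∣det-adjMat∣-even k) (∣det-walkMat∣-even k) ⟩
    a ℕ.* (a ℕ.^ k ℕ.* b ℕ.* p ℕ.^ k)                    ≡⟨ regroup a b (a ℕ.^ k) (p ℕ.^ k) ⟩
    a ℕ.^ suc k ℕ.* b ℕ.* p ℕ.^ k                        ∎
    where
    E = seqG G₀ (double k)
    regroup : ∀ a b x y → a ℕ.* (x ℕ.* b ℕ.* y) ≡ a ℕ.* x ℕ.* b ℕ.* y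
    regroup = ℕ-Solver.solve-∀

  ∣det-walkMat∣-even zero    = unit b
    where
    unit : ∀ b → b ≡ 1 ℕ.* b ℕ.* 1
    unit = ℕ-Solver.solve-∀
  ∣det-walkMat∣-even (suc k) = begin
    ∣ det (walkMat (seqG G₀ (double (suc k)))) ∣              ≡⟨ cong (λ h → ∣ det (walkMat h) ∣) (seqG-even G₀ k) ⟩
    ∣ det (walkMat (addCone O)) ∣                             ≡⟨ ∣det-walkMat-complement∣ {g = addCone O} (addCone-loopless O-loopless) ⟨
    ∣ det (walkMat (complement (addCone O))) ∣                ≡⟨ cong ∣_∣ (det-cong (walkMat-cong (complement-addCone O))) ⟩
    ∣ det (walkMat (addIsolated (complement O))) ∣            ≡⟨ cong ∣_∣ (det-walkMat-addIsolated (complement O)) ⟩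
    ∣ det (adjMat (complement O)) * det (walkMat (complement O)) ∣
                                                              ≡⟨ ℤ.abs-* (det (adjMat (complement O))) (det (walkMat (complement O))) ⟩
    ∣ det (adjMat (complement O)) ∣ ℕ.* ∣ det (walkMat (complement O)) ∣
                                                              ≡⟨ cong₂ ℕ._*_ (∣det-adjMat-complement∣-odd k)
                                                                   (trans (∣det-walkMat-complement∣ {g = O} O-loopless) (∣det-walkMat∣-odd k)) ⟩
    p ℕ.* (a ℕ.^ suc k ℕ.* b ℕ.* p ℕ.^ k)                      ≡⟨ regroup p b (a ℕ.^ suc k) (p ℕ.^ k) ⟩
    a ℕ.^ suc k ℕ.* b ℕ.* p ℕ.^ suc k                         ∎
    where
    O = seqG G₀ (suc (double k))
    O-loopless : Loopless O
    O-loopless = seqG-loopless loopless (suc (double k))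
    regroup : ∀ p b x y → p ℕ.* (x ℕ.* b ℕ.* y) ≡ x ℕ.* b ℕ.* (p ℕ.* y)
    regroup = ℕ-Solver.solve-∀

parity : ∀ i → (∃ λ k → i ≡ double k) ⊎ (∃ λ k → i ≡ suc (double k))
parity zero = inj₁ (zero , refl)
parity (suc i) with parity i
... | inj₁ (k , i≡2k)   = inj₂ (k , cong suc i≡2k)
... | inj₂ (k , i≡2k+1) = inj₁ (suc k , cong suc i≡2k+1)

⌊double/2⌋ : ∀ k → ⌊ double k /2⌋ ≡ k
⌊double/2⌋ zero    = refl
⌊double/2⌋ (suc k) = cong suc (⌊double/2⌋ k)

⌊1+double/2⌋ : ∀ k → ⌊ suc (double k) /2⌋ ≡ k
⌊1+double/2⌋ zero    = refl
⌊1+double/2⌋ (suc k) = cong suc (⌊1+double/2⌋ k)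

theorem3p3 : ∀ {n} (G₀ : Graph n) → IsSimple G₀ → (i : ℕ) →
    ∣ det (walkMat (seqG G₀ (suc i))) ∣
      ≡ ∣ det (adjMat G₀) ∣ ℕ.^ ⌈ suc i /2⌉ ℕ.* ∣ det (walkMat G₀) ∣
        ℕ.* ∣ det (adjMat (complement (seqG G₀ 1))) ∣ ℕ.^ ⌊ suc i /2⌋
theorem3p3 G₀ (_ , loopless) i with parity i
... | inj₁ (k , refl) rewrite ⌊double/2⌋ k | ⌊1+double/2⌋ k = AlternatingExtensions.∣det-walkMat∣-odd G₀ loopless k
... | inj₂ (k , refl) rewrite ⌊1+double/2⌋ k | ⌊double/2⌋ k = AlternatingExtensions.∣det-walkMat∣-even G₀ loopless (suc k)
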